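{- If $n\ge 3$, then $\mathrm{ex}(n,M_2,S_4)=n(n-3)/2$.
   Context: $M_2$ is the matching with two edges; $S_4$ is the star with three leaves. $\mathcal{N}(H,G)$ is the number of subgraphs of $G$ isomorphic to $H$; $\mathrm{ex}(n,H,F)$ is the maximum of $\mathcal{N}(H,G)$ over $F$-free $n$-vertex graphs $G$. -}

module Defs where

open import Data.Nat using (ℕ; zero; suc; _+_; _*_; _∸_; _≤_)
open import Data.Nat.DivMod using (_/_)
open import Data.Bool using (Bool; true; false; _∧_)
open import Data.Fin using (Fin; _<?_; _≟_)
open import Data.List using (List; map; allFin)
open import Data.Nat.ListAction using (sum)
open import Data.Product using (Σ; _×_; ∃)
open import Relation.Nullary using (¬_)
open import Relation.Nullary.Decidable using (⌊_⌋; ¬?)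
open import Relation.Binary.PropositionalEquality using (_≡_; _≢_)

record Graph (n : ℕ) : Set where
  field
    adj    : Fin n → Fin n → Bool
    sym    : ∀ i j → adj i j ≡ adj j i
    irrefl : ∀ i → adj i i ≡ false
open Graph public

-- G contains a subgraph isomorphic to S_4 (star with three leaves):
-- a centre v with three pairwise distinct neighbours.
ContainsS4 : ∀ {n} → Graph n → Set
ContainsS4 {n} G =
  Σ (Fin n) λ v → Σ (Fin n) λ x → Σ (Fin n) λ y → Σ (Fin n) λ z →
    (x ≢ y) × (x ≢ z) × (y ≢ z) ×
    (adj G v x ≡ true) × (adj G v y ≡ true) × (adj G v z ≡ true)

S4Free : ∀ {n} → Graph n → Set
S4Free G = ¬ ContainsS4 G

ind : Bool → ℕ
ind true  = 1
ind false = 0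

Σv : ∀ {n} → (Fin n → ℕ) → ℕ
Σv {n} f = sum (map f (allFin n))

-- Each copy of M_2 (two vertex-disjoint edges) is the edge set {ab, cd}
-- with a < b, c < d, a < c (canonical representative), all four vertices
-- distinct.
isM2 : ∀ {n} → Graph n → Fin n → Fin n → Fin n → Fin n → Bool
isM2 G a b c d =
  ⌊ a <? b ⌋ ∧ ⌊ c <? d ⌋ ∧ ⌊ a <? c ⌋ ∧
  ⌊ ¬? (b ≟ c) ⌋ ∧ ⌊ ¬? (b ≟ d) ⌋ ∧ adj G a b ∧ adj G c d

countM2 : ∀ {n} → Graph n → ℕ
countM2 G = Σv λ a → Σv λ b → Σv λ c → Σv λ d → ind (isM2 G a b c d)

-- Two distinct edges either share a vertex or form a copy of M₂, so with e edges and degrees d(v),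
-- 2·N(M₂, G) = e² + e − Σ d(v)².  In an S₄-free graph every degree is at most 2, hence e ≤ n,
-- Σ d² ≥ 2e and, from (d − 1)(d − 2) ≥ 0, Σ d² ≥ 6e − 2n; together these bound e² + e − Σ d² by
-- n(n − 3).  The cycle Cₙ is S₄-free and 2-regular, so e = n and Σ d² = 4n give equality.
module Submission where

open import Defs hiding (sym)
open import Data.Bool using (Bool; true; false; _∧_; _∨_)
open import Data.Bool.Properties using (∧-zeroʳ; ∨-comm; ∨-zeroʳ)
open import Data.Empty using (⊥-elim)
open import Data.Fin using (Fin; zero; suc; toℕ; fromℕ<; _<?_; _≟_)
open import Data.Fin.Properties using (toℕ-injective; toℕ<n; toℕ-fromℕ<; fromℕ<-injective)
open import Data.List using (allFin; map; tabulate)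
open import Data.List.Properties using (map-tabulate)
open import Data.Nat using (ℕ; zero; suc; _+_; _*_; _∸_; _≤_; _<_; z≤n; s≤s; s≤s⁻¹)
  renaming (_≟_ to _≟ℕ_)
open import Data.Nat.DivMod using (_/_; m*n/n≡m; /-monoˡ-≤)
open import Data.Nat.ListAction using () renaming (sum to listSum)
open import Data.Nat.Properties hiding (_≟_; _<?_)
open import Algebra.Properties.Semiring.Sum +-*-semiring
  using (sum-syntax; sum-cong-≗; sum-replicate-zero; ∑-distrib-+; *-distribˡ-sum; *-distribʳ-sum)
open import Data.Nat.Tactic.RingSolver using (solve-∀)
open import Algebra.Properties.CommutativeSemigroup +-commutativeSemigroup
  using () renaming (interchange to +-interchange)
open import Data.Product using (Σ; _×_; _,_)
open import Data.Sum using (_⊎_; inj₁; inj₂)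
open import Function using (_∘_; id)
open import Relation.Binary.PropositionalEquality
open import Relation.Nullary using (Dec; yes; ¬_)
open import Relation.Nullary.Decidable using (⌊_⌋; ¬?; isYes≗does; dec-true; dec-false)

Σv≡∑ : ∀ {n} (f : Fin n → ℕ) → Σv f ≡ ∑[ i < n ] f i
Σv≡∑ {zero}  f = refl
Σv≡∑ {suc n} f = cong (f zero +_) (trans (cong listSum allFin-suc) (Σv≡∑ (f ∘ suc)))
  where
  allFin-suc : map f (tabulate suc) ≡ map (f ∘ suc) (allFin n)
  allFin-suc = trans (map-tabulate suc f) (sym (map-tabulate id (f ∘ suc)))

∑-const : ∀ n k → ∑[ i < n ] k ≡ n * k
∑-const zero    k = refl
∑-const (suc n) k = cong (k +_) (∑-const n k)

∑-zero : ∀ {n} {f : Fin n → ℕ} → (∀ i → f i ≡ 0) → ∑[ i < n ] f i ≡ 0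
∑-zero {n} f≗0 = trans (sum-cong-≗ f≗0) (sum-replicate-zero n)

∑-mono-≤ : ∀ {n} {f g : Fin n → ℕ} → (∀ i → f i ≤ g i) → ∑[ i < n ] f i ≤ ∑[ i < n ] g i
∑-mono-≤ {zero}  f≤g = z≤n
∑-mono-≤ {suc n} f≤g = +-mono-≤ (f≤g zero) (∑-mono-≤ (f≤g ∘ suc))

*-distribˡ-∑∑ : ∀ {m n} x (t : Fin m → Fin n → ℕ) →
  x * ∑[ c < m ] ∑[ d < n ] t c d ≡ ∑[ c < m ] ∑[ d < n ] (x * t c d)
*-distribˡ-∑∑ {n = n} x t =
  trans (*-distribˡ-sum x λ c → ∑[ d < n ] t c d) (sum-cong-≗ λ c → *-distribˡ-sum x (t c))

isYes⇒ : ∀ {p} {P : Set p} (P? : Dec P) → ⌊ P? ⌋ ≡ true → P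
isYes⇒ (yes p) _ = p

isYes-true : ∀ {p} {P : Set p} (P? : Dec P) → P → ⌊ P? ⌋ ≡ true
isYes-true P? p = trans (isYes≗does P?) (dec-true P? p)

isYes-false : ∀ {p} {P : Set p} (P? : Dec P) → ¬ P → ⌊ P? ⌋ ≡ false
isYes-false P? ¬p = trans (isYes≗does P?) (dec-false P? ¬p)

isYes-suc<?suc : ∀ {n} (a b : Fin n) → ⌊ suc a <? suc b ⌋ ≡ ⌊ a <? b ⌋
isYes-suc<?suc a b = trans (isYes≗does (suc a <? suc b)) (sym (isYes≗does (a <? b)))

isYes-suc≢?suc : ∀ {n} (a b : Fin n) → ⌊ ¬? (suc a ≟ suc b) ⌋ ≡ ⌊ ¬? (a ≟ b) ⌋
isYes-suc≢?suc a b = trans (isYes≗does (¬? (suc a ≟ suc b))) (sym (isYes≗does (¬? (a ≟ b))))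

∧-true : ∀ x y → x ∧ y ≡ true → x ≡ true × y ≡ true
∧-true true true _ = refl , refl

∨-true : ∀ x y → x ∨ y ≡ true → x ≡ true ⊎ y ≡ true
∨-true true  y _    = inj₁ refl
∨-true false y y≡tt = inj₂ y≡tt

ind-idem : ∀ x → ind x * ind x ≡ ind x
ind-idem true  = refl
ind-idem false = refl

ind-∧-pull : ∀ p q r x s → ind (p ∧ q ∧ r ∧ x ∧ s) ≡ ind x * ind (p ∧ q ∧ r ∧ s)
ind-∧-pull p     q     r     true  s = sym (+-identityʳ _)
ind-∧-pull true  true  true  false s = refl
ind-∧-pull true  true  false false s = refl
ind-∧-pull true  false r     false s = refl
ind-∧-pull false q     r     false s = refl

count : ∀ {n} → (Fin n → Bool) → ℕ
count {n} f = ∑[ w < n ] ind (f w)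

without : ∀ {n} → Fin n → (Fin n → Bool) → Fin n → Bool
without x f w = ⌊ ¬? (x ≟ w) ⌋ ∧ f w

without-true : ∀ {n} {x w : Fin n} (f : Fin n → Bool) → without x f w ≡ true → x ≢ w × f w ≡ true
without-true {x = x} {w} f eq with ∧-true ⌊ ¬? (x ≟ w) ⌋ (f w) eq
... | x≢w , fw = isYes⇒ (¬? (x ≟ w)) x≢w , fw

without-true⁻ : ∀ {n} {x w : Fin n} (f : Fin n → Bool) → x ≢ w → f w ≡ true → without x f w ≡ true
without-true⁻ {x = x} {w} f x≢w fw = cong₂ _∧_ (isYes-true (¬? (x ≟ w)) x≢w) fw

count-without : ∀ {n} (x : Fin n) (f : Fin n → Bool) → count (without x f) + ind (f x) ≡ count f
count-without {suc n} zero    f = +-comm (count (f ∘ suc)) (ind (f zero))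
count-without {suc n} (suc x) f = begin
  ind (f zero) + count (without (suc x) f ∘ suc) + ind (f (suc x))
    ≡⟨ cong (λ k → ind (f zero) + k + ind (f (suc x)))
            (sum-cong-≗ λ w → cong (λ b → ind (b ∧ f (suc w))) (isYes-suc≢?suc x w)) ⟩
  ind (f zero) + count (without x (f ∘ suc)) + ind (f (suc x))
    ≡⟨ +-assoc (ind (f zero)) _ _ ⟩
  ind (f zero) + (count (without x (f ∘ suc)) + ind (f (suc x)))
    ≡⟨ cong (ind (f zero) +_) (count-without x (f ∘ suc)) ⟩
  count f ∎
  where open ≡-Reasoning

count-suc-without : ∀ {n} (f : Fin n → Bool) {x : Fin n} → f x ≡ true →
                    count f ≡ suc (count (without x f))
count-suc-without f {x} fx = begin
  count f                             ≡⟨ count-without x f ⟨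
  count (without x f) + ind (f x)     ≡⟨ cong (λ b → count (without x f) + ind b) fx ⟩
  count (without x f) + 1             ≡⟨ +-comm _ 1 ⟩
  suc (count (without x f))           ∎
  where open ≡-Reasoning

count-witness : ∀ {n} (f : Fin n → Bool) → 1 ≤ count f → Σ (Fin n) λ x → f x ≡ true
count-witness {suc n} f pos with f zero in eq
... | true  = zero , eq
... | false with count-witness (f ∘ suc) pos
...   | x , fx = suc x , fx

count-≥1 : ∀ {n} (f : Fin n → Bool) {x : Fin n} → f x ≡ true → 1 ≤ count f
count-≥1 f fx rewrite count-suc-without f fx = s≤s z≤n

count-≥2 : ∀ {n} (f : Fin n → Bool) {x y : Fin n} → x ≢ y → f x ≡ true → f y ≡ true → 2 ≤ count f
count-≥2 f x≢y fx fy rewrite count-suc-without f fx =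
  s≤s (count-≥1 (without _ f) (without-true⁻ f x≢y fy))

two-witnesses : ∀ {n} (f : Fin n → Bool) → 2 ≤ count f →
  Σ (Fin n) λ x → Σ (Fin n) λ y → x ≢ y × f x ≡ true × f y ≡ true
two-witnesses f two =
  let x , fx      = count-witness f (≤-trans (s≤s z≤n) two)
      y , fy′     = count-witness (without x f) (s≤s⁻¹ (subst (2 ≤_) (count-suc-without f fx) two))
      x≢y , fy    = without-true f fy′
  in x , y , x≢y , fx , fy

three-witnesses : ∀ {n} (f : Fin n → Bool) → 3 ≤ count f →
  Σ (Fin n) λ x → Σ (Fin n) λ y → Σ (Fin n) λ z →
    x ≢ y × x ≢ z × y ≢ z × f x ≡ true × f y ≡ true × f z ≡ true
three-witnesses f three =
  let x , fx                  = count-witness f (≤-trans (s≤s z≤n) three)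
      y , z , y≢z , fy′ , fz′ =
        two-witnesses (without x f) (s≤s⁻¹ (subst (3 ≤_) (count-suc-without f fx) three))
      x≢y , fy                = without-true f fy′
      x≢z , fz                = without-true f fz′
  in x , y , z , x≢y , x≢z , y≢z , fx , fy , fz

degree : ∀ {n} → Graph n → Fin n → ℕ
degree G v = count (adj G v)

edgeCount : ∀ {n} → Graph n → ℕ
edgeCount {n} G = ∑[ a < n ] ∑[ b < n ] ind (⌊ a <? b ⌋ ∧ adj G a b)

edgesAvoiding : ∀ {n} → Graph n → Fin n → ℕ
edgesAvoiding {n} G v =
  ∑[ c < n ] ∑[ d < n ] ind (⌊ c <? d ⌋ ∧ ⌊ ¬? (v ≟ c) ⌋ ∧ ⌊ ¬? (v ≟ d) ⌋ ∧ adj G c d)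

degreeSquareSum : ∀ {n} → Graph n → ℕ
degreeSquareSum {n} G = ∑[ v < n ] (degree G v * degree G v)

m2Sum : ∀ {n} → Graph n → ℕ
m2Sum {n} G = ∑[ a < n ] ∑[ b < n ] ∑[ c < n ] ∑[ d < n ] ind (isM2 G a b c d)

countM2≡m2Sum : ∀ {n} (G : Graph n) → countM2 G ≡ m2Sum G
countM2≡m2Sum G =
  trans (Σv≡∑ λ a → Σv λ b → Σv λ c → Σv λ d → ind (isM2 G a b c d)) (sum-cong-≗ λ a →
  trans (Σv≡∑ λ b → Σv λ c → Σv λ d → ind (isM2 G a b c d)) (sum-cong-≗ λ b →
  trans (Σv≡∑ λ c → Σv λ d → ind (isM2 G a b c d)) (sum-cong-≗ λ c →
  Σv≡∑ λ d → ind (isM2 G a b c d))))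

removeZero : ∀ {n} → Graph (suc n) → Graph n
removeZero G = record
  { adj    = λ v w → adj G (suc v) (suc w)
  ; sym    = λ v w → Graph.sym G (suc v) (suc w)
  ; irrefl = λ v → irrefl G (suc v)
  }

linkToZero : ∀ {n} → Graph (suc n) → Fin n → ℕ
linkToZero G b = ind (adj G zero (suc b))

degree-zero : ∀ {n} (G : Graph (suc n)) → degree G zero ≡ ∑[ b < n ] linkToZero G b
degree-zero G rewrite irrefl G zero = refl

degree-suc : ∀ {n} (G : Graph (suc n)) b → degree G (suc b) ≡ linkToZero G b + degree (removeZero G) b
degree-suc G b rewrite Graph.sym G (suc b) zero = refl

edgeCount-removeZero : ∀ {n} (G : Graph (suc n)) →
  edgeCount G ≡ degree G zero + edgeCount (removeZero G)
edgeCount-removeZero G = cong₂ _+_ (sym (degree-zero G))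
  (sum-cong-≗ λ a → sum-cong-≗ λ b → cong (λ x → ind (x ∧ adj G (suc a) (suc b))) (isYes-suc<?suc a b))

edgesAvoiding-zero : ∀ {n} (G : Graph (suc n)) → edgesAvoiding G zero ≡ edgeCount (removeZero G)
edgesAvoiding-zero {n} G = cong₂ _+_ (∑-zero {n} λ _ → refl)
  (sum-cong-≗ λ c → sum-cong-≗ λ d → cong (λ x → ind (x ∧ adj G (suc c) (suc d))) (isYes-suc<?suc c d))

isYes-avoiding-suc : ∀ {n} (b c d : Fin n) s →
  ⌊ suc c <? suc d ⌋ ∧ ⌊ ¬? (suc b ≟ suc c) ⌋ ∧ ⌊ ¬? (suc b ≟ suc d) ⌋ ∧ s ≡
  ⌊ c <? d ⌋ ∧ ⌊ ¬? (b ≟ c) ⌋ ∧ ⌊ ¬? (b ≟ d) ⌋ ∧ s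
isYes-avoiding-suc b c d s
  rewrite isYes-suc<?suc c d | isYes-suc≢?suc b c | isYes-suc≢?suc b d = refl

edgesAvoiding-suc : ∀ {n} (G : Graph (suc n)) b →
  edgesAvoiding G (suc b) ≡ count (without b (adj G zero ∘ suc)) + edgesAvoiding (removeZero G) b
edgesAvoiding-suc G b = cong₂ _+_
  (sum-cong-≗ λ d → cong (λ x → ind (x ∧ adj G zero (suc d))) (isYes-suc≢?suc b d))
  (sum-cong-≗ λ c → sum-cong-≗ λ d → cong ind (isYes-avoiding-suc b c d (adj G (suc c) (suc d))))

edgesAvoiding+degree : ∀ {n} (G : Graph n) v → edgesAvoiding G v + degree G v ≡ edgeCount G
edgesAvoiding+degree {suc n} G zero = begin
  edgesAvoiding G zero + degree G zero     ≡⟨ cong (_+ degree G zero) (edgesAvoiding-zero G) ⟩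
  edgeCount (removeZero G) + degree G zero ≡⟨ +-comm _ (degree G zero) ⟩
  degree G zero + edgeCount (removeZero G) ≡⟨ edgeCount-removeZero G ⟨
  edgeCount G                              ∎
  where open ≡-Reasoning
edgesAvoiding+degree {suc n} G (suc b) = begin
  edgesAvoiding G (suc b) + degree G (suc b)
    ≡⟨ cong₂ _+_ (edgesAvoiding-suc G b) (degree-suc G b) ⟩
  (count (without b f) + edgesAvoiding H b) + (ind (f b) + degree H b)
    ≡⟨ +-interchange (count (without b f)) _ _ _ ⟩
  (count (without b f) + ind (f b)) + (edgesAvoiding H b + degree H b)
    ≡⟨ cong₂ _+_ (count-without b f) (edgesAvoiding+degree H b) ⟩
  count f + edgeCount H
    ≡⟨ cong (_+ edgeCount H) (degree-zero G) ⟨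
  degree G zero + edgeCount H
    ≡⟨ edgeCount-removeZero G ⟨
  edgeCount G ∎
  where
  open ≡-Reasoning
  H = removeZero G
  f = adj G zero ∘ suc

handshake : ∀ {n} (G : Graph n) → ∑[ v < n ] degree G v ≡ 2 * edgeCount G
handshake {zero}  G = refl
handshake {suc n} G = begin
  degree G zero + ∑[ b < n ] degree G (suc b)
    ≡⟨ cong (degree G zero +_) (sum-cong-≗ (degree-suc G)) ⟩
  degree G zero + ∑[ b < n ] (linkToZero G b + degree H b)
    ≡⟨ cong (degree G zero +_) (∑-distrib-+ (linkToZero G) (degree H)) ⟩
  degree G zero + (∑[ b < n ] linkToZero G b + ∑[ b < n ] degree H b)
    ≡⟨ cong (λ x → degree G zero + (x + ∑[ b < n ] degree H b)) (degree-zero G) ⟨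
  degree G zero + (degree G zero + ∑[ b < n ] degree H b)
    ≡⟨ cong (λ x → degree G zero + (degree G zero + x)) (handshake H) ⟩
  degree G zero + (degree G zero + 2 * edgeCount H)
    ≡⟨ double-sum (degree G zero) (edgeCount H) ⟩
  2 * (degree G zero + edgeCount H)
    ≡⟨ cong (2 *_) (edgeCount-removeZero G) ⟨
  2 * edgeCount G ∎
  where
  open ≡-Reasoning
  H = removeZero G
  double-sum : ∀ x e → x + (x + 2 * e) ≡ 2 * (x + e)
  double-sum = solve-∀

isM2-removeZero : ∀ {n} (G : Graph (suc n)) a b c d →
  isM2 G (suc a) (suc b) (suc c) (suc d) ≡ isM2 (removeZero G) a b c d
isM2-removeZero G a b c d
  rewrite isYes-suc<?suc a b | isYes-suc<?suc c d | isYes-suc<?suc a c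
        | isYes-suc≢?suc b c | isYes-suc≢?suc b d = refl

-- The canonical representative ab, cd of a copy of M₂ has a < b and a < c < d, so vertex 0 can
-- only be a; such copies are an edge 0b together with an edge of G − 0 avoiding b.
m2Sum-removeZero : ∀ {n} (G : Graph (suc n)) →
  m2Sum G ≡ ∑[ b < n ] (linkToZero G b * edgesAvoiding (removeZero G) b) + m2Sum (removeZero G)
m2Sum-removeZero {n} G = cong₂ _+_ rowZero (sum-cong-≗ rowSuc)
  where
  H = removeZero G
  avoids : Fin n → Fin n → Fin n → ℕ
  avoids b c d = ind (⌊ c <? d ⌋ ∧ ⌊ ¬? (b ≟ c) ⌋ ∧ ⌊ ¬? (b ≟ d) ⌋ ∧ adj H c d)

  edgeAtZero : ∀ b c d → ind (isM2 G zero (suc b) (suc c) (suc d)) ≡ linkToZero G b * avoids b c d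
  edgeAtZero b c d =
    trans (cong ind (isYes-avoiding-suc b c d (adj G zero (suc b) ∧ adj H c d)))
          (ind-∧-pull ⌊ c <? d ⌋ ⌊ ¬? (b ≟ c) ⌋ ⌊ ¬? (b ≟ d) ⌋ (adj G zero (suc b)) (adj H c d))

  rowZero : ∑[ b < suc n ] ∑[ c < suc n ] ∑[ d < suc n ] ind (isM2 G zero b c d)
          ≡ ∑[ b < n ] (linkToZero G b * edgesAvoiding H b)
  rowZero = cong₂ _+_ (∑-zero {suc n} λ _ → ∑-zero {suc n} λ _ → refl) (sum-cong-≗ λ b →
    trans (cong₂ _+_ (∑-zero {n} λ _ → refl) (sum-cong-≗ λ c → sum-cong-≗ λ d → edgeAtZero b c d))
          (sym (*-distribˡ-∑∑ (linkToZero G b) (avoids b))))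

  rowSuc : ∀ a → ∑[ b < suc n ] ∑[ c < suc n ] ∑[ d < suc n ] ind (isM2 G (suc a) b c d) ≡
                 ∑[ b < n ] ∑[ c < n ] ∑[ d < n ] ind (isM2 H a b c d)
  rowSuc a = cong₂ _+_ (∑-zero {suc n} λ _ → ∑-zero {suc n} λ _ → refl) (sum-cong-≗ λ b →
    cong₂ _+_ (cong₂ _+_ (noEdge b) (∑-zero {n} λ _ → noEdge b))
              (sum-cong-≗ λ c → cong₂ _+_ (noEdge b)
                 (sum-cong-≗ λ d → cong ind (isM2-removeZero G a b c d))))
    where
    noEdge : ∀ b → ind (⌊ suc a <? suc b ⌋ ∧ false) ≡ 0
    noEdge b = cong ind (∧-zeroʳ ⌊ suc a <? suc b ⌋)

degreeSquareSum-removeZero : ∀ {n} (G : Graph (suc n)) →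
  let X = degree G zero; H = removeZero G in
  degreeSquareSum G ≡ X * X + (X + (2 * ∑[ b < n ] (linkToZero G b * degree H b) + degreeSquareSum H))
degreeSquareSum-removeZero {n} G = cong (degree G zero * degree G zero +_) (begin
  ∑[ b < n ] (degree G (suc b) * degree G (suc b))
    ≡⟨ sum-cong-≗ square-suc ⟩
  ∑[ b < n ] (x b + (2 * (x b * d b) + d b * d b))
    ≡⟨ ∑-distrib-+ x _ ⟩
  ∑[ b < n ] x b + ∑[ b < n ] (2 * (x b * d b) + d b * d b)
    ≡⟨ cong₂ _+_ (degree-zero G) (sym (∑-distrib-+ (λ b → 2 * (x b * d b)) _)) ⟨
  degree G zero + (∑[ b < n ] (2 * (x b * d b)) + degreeSquareSum H)
    ≡⟨ cong (λ s → degree G zero + (s + degreeSquareSum H)) (*-distribˡ-sum 2 λ b → x b * d b) ⟨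
  degree G zero + (2 * ∑[ b < n ] (x b * d b) + degreeSquareSum H) ∎)
  where
  open ≡-Reasoning
  H = removeZero G
  x = linkToZero G
  d = degree H
  expand : ∀ x d → (x + d) * (x + d) ≡ x * x + (2 * (x * d) + d * d)
  expand = solve-∀
  square-suc : ∀ b → degree G (suc b) * degree G (suc b) ≡ x b + (2 * (x b * d b) + d b * d b)
  square-suc b rewrite degree-suc G b =
    trans (expand (x b) (d b)) (cong (_+ (2 * (x b * d b) + d b * d b)) (ind-idem (adj G zero (suc b))))

m2Sum-identity : ∀ {n} (G : Graph n) →
  2 * m2Sum G + degreeSquareSum G ≡ edgeCount G * edgeCount G + edgeCount G
m2Sum-identity {zero}  G = refl
m2Sum-identity {suc n} G = begin
  2 * m2Sum G + degreeSquareSum G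
    ≡⟨ cong₂ (λ m q → 2 * m + q) (m2Sum-removeZero G) (degreeSquareSum-removeZero G) ⟩
  2 * (Z + m2Sum H) + (X * X + (X + (2 * D + degreeSquareSum H)))
    ≡⟨ regroup Z D (m2Sum H) X (degreeSquareSum H) ⟩
  2 * (Z + D) + (2 * m2Sum H + degreeSquareSum H) + X * X + X
    ≡⟨ cong₂ (λ u v → 2 * u + v + X * X + X) weighted (m2Sum-identity H) ⟩
  2 * (X * e) + (e * e + e) + X * X + X
    ≡⟨ square X e ⟩
  (X + e) * (X + e) + (X + e)
    ≡⟨ cong (λ k → k * k + k) (edgeCount-removeZero G) ⟨
  edgeCount G * edgeCount G + edgeCount G ∎
  where
  open ≡-Reasoning
  H = removeZero G
  X = degree G zero
  e = edgeCount H
  x = linkToZero G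
  Z = ∑[ b < n ] (x b * edgesAvoiding H b)
  D = ∑[ b < n ] (x b * degree H b)
  regroup : ∀ z d m x q →
    2 * (z + m) + (x * x + (x + (2 * d + q))) ≡ 2 * (z + d) + (2 * m + q) + x * x + x
  regroup = solve-∀
  square : ∀ x e → 2 * (x * e) + (e * e + e) + x * x + x ≡ (x + e) * (x + e) + (x + e)
  square = solve-∀
  weighted : Z + D ≡ X * e
  weighted = begin
    Z + D                               ≡⟨ ∑-distrib-+ (λ b → x b * edgesAvoiding H b) _ ⟨
    ∑[ b < n ] (x b * edgesAvoiding H b + x b * degree H b)
                                        ≡⟨ sum-cong-≗ (λ b → *-distribˡ-+ (x b) _ _) ⟨
    ∑[ b < n ] (x b * (edgesAvoiding H b + degree H b))
                                        ≡⟨ sum-cong-≗ (λ b → cong (x b *_) (edgesAvoiding+degree H b)) ⟩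
    ∑[ b < n ] (x b * e)                ≡⟨ *-distribʳ-sum e x ⟨
    ∑[ b < n ] x b * e                  ≡⟨ cong (_* e) (degree-zero G) ⟨
    X * e                               ∎

countM2-identity : ∀ {n} (G : Graph n) →
  2 * countM2 G + degreeSquareSum G ≡ edgeCount G * edgeCount G + edgeCount G
countM2-identity G rewrite countM2≡m2Sum G = m2Sum-identity G

S4Free⇒degree≤2 : ∀ {n} (G : Graph n) → S4Free G → ∀ v → degree G v ≤ 2
S4Free⇒degree≤2 G free v = ≮⇒≥ λ 2<d →
  let x , y , z , x≢y , x≢z , y≢z , vx , vy , vz = three-witnesses (adj G v) 2<d
  in free (v , x , y , z , x≢y , x≢z , y≢z , vx , vy , vz)

n≤n*n : ∀ n → n ≤ n * n
n≤n*n zero    = z≤n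
n≤n*n (suc n) = m≤m*n (suc n) (suc n)

3n≤n*n+2 : ∀ n → n ≤ 2 → 3 * n ≤ n * n + 2
3n≤n*n+2 0 _ = z≤n
3n≤n*n+2 1 _ = ≤-refl
3n≤n*n+2 2 _ = ≤-refl
3n≤n*n+2 (suc (suc (suc _))) (s≤s (s≤s ()))

-- For e ≤ 1 there is no copy of M₂; for e ≥ 2, writing n = e + k, the bound reduces to 5k ≤ 2ek + k².
m2-arithmetic : ∀ {n c e q} → 3 ≤ n → e ≤ n →
  2 * c + q ≡ e * e + e → 2 * e ≤ q → 6 * e ≤ q + 2 * n → 2 * c + 3 * n ≤ n * n
m2-arithmetic {n} {c} {0} {q} 3≤n _ ident _ _ =
  subst (λ k → k + 3 * n ≤ n * n) (sym (m+n≡0⇒m≡0 (2 * c) ident)) (*-monoˡ-≤ n 3≤n)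
m2-arithmetic {n} {c} {1} {q} 3≤n _ ident 2≤q _ =
  subst (λ k → k + 3 * n ≤ n * n) (sym (n≤0⇒n≡0 2c≤0)) (*-monoˡ-≤ n 3≤n)
  where
  2c≤0 : 2 * c ≤ 0
  2c≤0 = +-cancelʳ-≤ 2 (2 * c) 0 (≤-trans (+-monoʳ-≤ (2 * c) 2≤q) (≤-reflexive ident))
m2-arithmetic {c = c} {suc (suc e)} {q} _ e≤n ident _ 6E≤q+2n with m≤n⇒∃[o]m+o≡n e≤n
... | k , refl = +-cancelʳ-≤ (3 * E) (2 * c + 3 * n) (n * n) (begin
  2 * c + 3 * n + 3 * E              ≡⟨ shift c e k ⟩
  2 * c + 6 * E + 3 * k              ≤⟨ +-monoˡ-≤ (3 * k) (+-monoʳ-≤ (2 * c) 6E≤q+2n) ⟩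
  2 * c + (q + 2 * n) + 3 * k        ≡⟨ cong (_+ 3 * k) (+-assoc (2 * c) q (2 * n)) ⟨
  2 * c + q + 2 * n + 3 * k          ≡⟨ cong (λ m → m + 2 * n + 3 * k) ident ⟩
  E * E + E + 2 * n + 3 * k          ≡⟨ collect e k ⟩
  E * E + 3 * E + (4 * k + k)        ≤⟨ +-monoʳ-≤ (E * E + 3 * E) (+-monoʳ-≤ (4 * k) k≤2ek+k*k) ⟩
  E * E + 3 * E + (4 * k + (2 * e * k + k * k)) ≡⟨ complete e k ⟩
  n * n + 3 * E                      ∎)
  where
  open ≤-Reasoning
  E = 2 + e
  n = E + k
  shift : ∀ c e k → 2 * c + 3 * (2 + e + k) + 3 * (2 + e) ≡ 2 * c + 6 * (2 + e) + 3 * k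
  shift = solve-∀
  collect : ∀ e k → (2 + e) * (2 + e) + (2 + e) + 2 * (2 + e + k) + 3 * k
                  ≡ (2 + e) * (2 + e) + 3 * (2 + e) + (4 * k + k)
  collect = solve-∀
  complete : ∀ e k → (2 + e) * (2 + e) + 3 * (2 + e) + (4 * k + (2 * e * k + k * k))
                   ≡ (2 + e + k) * (2 + e + k) + 3 * (2 + e)
  complete = solve-∀
  k≤2ek+k*k : k ≤ 2 * e * k + k * k
  k≤2ek+k*k = ≤-trans (n≤n*n k) (m≤n+m (k * k) (2 * e * k))

S4Free⇒countM2-bound : ∀ {n} → 3 ≤ n → (G : Graph n) → S4Free G → 2 * countM2 G + 3 * n ≤ n * n
S4Free⇒countM2-bound {n} 3≤n G free =
  m2-arithmetic {c = countM2 G} 3≤n e≤n (countM2-identity G) 2e≤q 6e≤q+2n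
  where
  open ≤-Reasoning
  d = degree G
  e = edgeCount G
  q = degreeSquareSum G
  d≤2 : ∀ v → d v ≤ 2
  d≤2 = S4Free⇒degree≤2 G free
  ∑2≡2n : ∑[ v < n ] 2 ≡ 2 * n
  ∑2≡2n = trans (∑-const n 2) (*-comm n 2)
  e≤n : e ≤ n
  e≤n = *-cancelˡ-≤ 2 (begin
    2 * e              ≡⟨ handshake G ⟨
    ∑[ v < n ] d v     ≤⟨ ∑-mono-≤ d≤2 ⟩
    ∑[ v < n ] 2       ≡⟨ ∑2≡2n ⟩
    2 * n              ∎)
  2e≤q : 2 * e ≤ q
  2e≤q = subst (_≤ q) (handshake G) (∑-mono-≤ λ v → n≤n*n (d v))
  6e≤q+2n : 6 * e ≤ q + 2 * n
  6e≤q+2n = begin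
    6 * e                         ≡⟨ *-assoc 3 2 e ⟩
    3 * (2 * e)                   ≡⟨ cong (3 *_) (handshake G) ⟨
    3 * ∑[ v < n ] d v            ≡⟨ *-distribˡ-sum 3 d ⟩
    ∑[ v < n ] (3 * d v)          ≤⟨ ∑-mono-≤ (λ v → 3n≤n*n+2 (d v) (d≤2 v)) ⟩
    ∑[ v < n ] (d v * d v + 2)    ≡⟨ ∑-distrib-+ (λ v → d v * d v) (λ _ → 2) ⟩
    q + ∑[ v < n ] 2              ≡⟨ cong (q +_) ∑2≡2n ⟩
    q + 2 * n                     ∎

2-regular⇒countM2 : ∀ {n} (G : Graph n) → (∀ v → degree G v ≡ 2) → 2 * countM2 G + 3 * n ≡ n * n
2-regular⇒countM2 {n} G regular = +-cancelʳ-≡ n (2 * countM2 G + 3 * n) (n * n) (begin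
  2 * countM2 G + 3 * n + n   ≡⟨ +-assoc (2 * countM2 G) (3 * n) n ⟩
  2 * countM2 G + (3 * n + n) ≡⟨ cong (2 * countM2 G +_) (3n+n≡n*4 n) ⟩
  2 * countM2 G + n * 4       ≡⟨ cong (2 * countM2 G +_) q≡n*4 ⟨
  2 * countM2 G + degreeSquareSum G
                              ≡⟨ countM2-identity G ⟩
  edgeCount G * edgeCount G + edgeCount G
                              ≡⟨ cong (λ k → k * k + k) e≡n ⟩
  n * n + n                   ∎)
  where
  open ≡-Reasoning
  3n+n≡n*4 : ∀ n → 3 * n + n ≡ n * 4
  3n+n≡n*4 = solve-∀
  e≡n : edgeCount G ≡ n
  e≡n = *-cancelˡ-≡ (edgeCount G) n 2
    (trans (sym (handshake G)) (trans (sum-cong-≗ regular) (trans (∑-const n 2) (*-comm n 2))))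
  q≡n*4 : degreeSquareSum G ≡ n * 4
  q≡n*4 = trans (sum-cong-≗ λ v → cong (λ k → k * k) (regular v)) (∑-const n 4)

2*c/2≡c : ∀ c → 2 * c / 2 ≡ c
2*c/2≡c c = trans (cong (_/ 2) (*-comm 2 c)) (m*n/n≡m c 2)

n*[n∸3]≡n*n∸3*n : ∀ n → n * (n ∸ 3) ≡ n * n ∸ 3 * n
n*[n∸3]≡n*n∸3*n n = trans (*-distribˡ-∸ n n 3) (cong (n * n ∸_) (*-comm n 3))

≤-half-n*[n∸3] : ∀ {n c} → 2 * c + 3 * n ≤ n * n → c ≤ n * (n ∸ 3) / 2
≤-half-n*[n∸3] {n} {c} bound = subst (_≤ n * (n ∸ 3) / 2) (2*c/2≡c c) (/-monoˡ-≤ 2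
  (subst (2 * c ≤_) (sym (n*[n∸3]≡n*n∸3*n n)) (m+n≤o⇒m≤o∸n (2 * c) bound)))

≡-half-n*[n∸3] : ∀ {n c} → 2 * c + 3 * n ≡ n * n → c ≡ n * (n ∸ 3) / 2
≡-half-n*[n∸3] {n} {c} exact = sym (begin
  n * (n ∸ 3) / 2               ≡⟨ cong (_/ 2) (n*[n∸3]≡n*n∸3*n n) ⟩
  (n * n ∸ 3 * n) / 2           ≡⟨ cong (λ m → (m ∸ 3 * n) / 2) exact ⟨
  (2 * c + 3 * n ∸ 3 * n) / 2   ≡⟨ cong (_/ 2) (m+n∸n≡m (2 * c) (3 * n)) ⟩
  2 * c / 2                     ≡⟨ 2*c/2≡c c ⟩
  c                             ∎)
  where open ≡-Reasoning

isCyclicSucc : ℕ → ℕ → ℕ → Bool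
isCyclicSucc t a b = ⌊ b ≟ℕ suc a ⌋ ∨ (⌊ a ≟ℕ 2 + t ⌋ ∧ ⌊ b ≟ℕ 0 ⌋)

isCyclicSucc-irrefl : ∀ t a → isCyclicSucc t a a ≡ false
isCyclicSucc-irrefl t zero    = refl
isCyclicSucc-irrefl t (suc a) =
  cong₂ _∨_ (isYes-false (suc a ≟ℕ suc (suc a)) (<⇒≢ (n<1+n (suc a)))) (∧-zeroʳ _)

isCyclicSucc-suc : ∀ t a → isCyclicSucc t a (suc a) ≡ true
isCyclicSucc-suc t a =
  cong (_∨ (⌊ a ≟ℕ 2 + t ⌋ ∧ ⌊ suc a ≟ℕ 0 ⌋)) (isYes-true (suc a ≟ℕ suc a) refl)

isCyclicSucc-last : ∀ t → isCyclicSucc t (2 + t) 0 ≡ true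
isCyclicSucc-last t = cong (_∧ true) (isYes-true (2 + t ≟ℕ 2 + t) refl)

isCyclicSucc⇒ : ∀ t a b → isCyclicSucc t a b ≡ true → b ≡ suc a ⊎ (a ≡ 2 + t × b ≡ 0)
isCyclicSucc⇒ t a b succ with ∨-true ⌊ b ≟ℕ suc a ⌋ _ succ
... | inj₁ b≡1+a    = inj₁ (isYes⇒ (b ≟ℕ suc a) b≡1+a)
... | inj₂ wrap with ∧-true ⌊ a ≟ℕ 2 + t ⌋ ⌊ b ≟ℕ 0 ⌋ wrap
...   | a≡last , b≡0 = inj₂ (isYes⇒ (a ≟ℕ 2 + t) a≡last , isYes⇒ (b ≟ℕ 0) b≡0)

isCyclicSucc-functional : ∀ t {a b c} → b < 3 + t → c < 3 + t →
  isCyclicSucc t a b ≡ true → isCyclicSucc t a c ≡ true → b ≡ c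
isCyclicSucc-functional t {a} {b} {c} b< c< ab ac with isCyclicSucc⇒ t a b ab | isCyclicSucc⇒ t a c ac
... | inj₁ b≡1+a         | inj₁ c≡1+a         = trans b≡1+a (sym c≡1+a)
... | inj₁ refl          | inj₂ (refl , _)    = ⊥-elim (<-irrefl refl b<)
... | inj₂ (refl , _)    | inj₁ refl          = ⊥-elim (<-irrefl refl c<)
... | inj₂ (_ , b≡0)     | inj₂ (_ , c≡0)     = trans b≡0 (sym c≡0)

isCyclicSucc-injective : ∀ t {a b c} →
  isCyclicSucc t b a ≡ true → isCyclicSucc t c a ≡ true → b ≡ c
isCyclicSucc-injective t {a} {b} {c} ba ca with isCyclicSucc⇒ t b a ba | isCyclicSucc⇒ t c a ca
... | inj₁ a≡1+b           | inj₁ a≡1+c           = suc-injective (trans (sym a≡1+b) a≡1+c)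
... | inj₁ refl            | inj₂ (_ , ())
... | inj₂ (_ , ())        | inj₁ refl
... | inj₂ (b≡last , _)    | inj₂ (c≡last , _)    = trans b≡last (sym c≡last)

cycleAdj : ℕ → ℕ → ℕ → Bool
cycleAdj t a b = isCyclicSucc t a b ∨ isCyclicSucc t b a

cycle : ∀ t → Graph (3 + t)
cycle t = record
  { adj    = λ v w → cycleAdj t (toℕ v) (toℕ w)
  ; sym    = λ v w → ∨-comm (isCyclicSucc t (toℕ v) (toℕ w)) (isCyclicSucc t (toℕ w) (toℕ v))
  ; irrefl = λ v → cong₂ _∨_ (isCyclicSucc-irrefl t (toℕ v)) (isCyclicSucc-irrefl t (toℕ v))
  }

cycleAdj-forward : ∀ t a b → isCyclicSucc t a b ≡ true → cycleAdj t a b ≡ true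
cycleAdj-forward t a b ab = cong (_∨ isCyclicSucc t b a) ab

cycleAdj-backward : ∀ t a b → isCyclicSucc t b a ≡ true → cycleAdj t a b ≡ true
cycleAdj-backward t a b ba = trans (cong (isCyclicSucc t a b ∨_) ba) (∨-zeroʳ _)

successor-unique : ∀ t {v x y : Fin (3 + t)} →
  isCyclicSucc t (toℕ v) (toℕ x) ≡ true → isCyclicSucc t (toℕ v) (toℕ y) ≡ true → x ≡ y
successor-unique t {x = x} {y} vx vy = toℕ-injective (isCyclicSucc-functional t (toℕ<n x) (toℕ<n y) vx vy)

predecessor-unique : ∀ t {v x y : Fin (3 + t)} →
  isCyclicSucc t (toℕ x) (toℕ v) ≡ true → isCyclicSucc t (toℕ y) (toℕ v) ≡ true → x ≡ y
predecessor-unique t xv yv = toℕ-injective (isCyclicSucc-injective t xv yv)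

cycle-S4Free : ∀ t → S4Free (cycle t)
cycle-S4Free t (v , x , y , z , x≢y , x≢z , y≢z , vx , vy , vz)
  with ∨-true (isCyclicSucc t (toℕ v) (toℕ x)) _ vx
     | ∨-true (isCyclicSucc t (toℕ v) (toℕ y)) _ vy
     | ∨-true (isCyclicSucc t (toℕ v) (toℕ z)) _ vz
... | inj₁ sx | inj₁ sy | _       = x≢y (successor-unique t sx sy)
... | inj₂ px | inj₂ py | _       = x≢y (predecessor-unique t px py)
... | inj₁ sx | inj₂ py | inj₁ sz = x≢z (successor-unique t sx sz)
... | inj₁ sx | inj₂ py | inj₂ pz = y≢z (predecessor-unique t py pz)
... | inj₂ px | inj₁ sy | inj₁ sz = y≢z (successor-unique t sy sz)
... | inj₂ px | inj₁ sy | inj₂ pz = x≢z (predecessor-unique t px pz)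

cycle-neighbours : ∀ t a → a < 3 + t →
  Σ ℕ λ b → Σ ℕ λ c → b < 3 + t × c < 3 + t × b ≢ c × cycleAdj t a b ≡ true × cycleAdj t a c ≡ true
cycle-neighbours t zero    _  =
  1 , 2 + t , s≤s (s≤s z≤n) , ≤-refl , (λ ()) ,
  cycleAdj-forward t 0 1 (isCyclicSucc-suc t 0) , cycleAdj-backward t 0 (2 + t) (isCyclicSucc-last t)
cycle-neighbours t (suc a) a< with m≤n⇒m<n∨m≡n (s≤s⁻¹ a<)
... | inj₂ refl =
  0 , 1 + t , s≤s z≤n , n≤1+n (2 + t) , (λ ()) ,
  cycleAdj-forward t (2 + t) 0 (isCyclicSucc-last t) ,
  cycleAdj-backward t (2 + t) (1 + t) (isCyclicSucc-suc t (1 + t))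
... | inj₁ 2+a< =
  2 + a , a , s≤s 2+a< , <-trans (n<1+n a) a< , (λ eq → <⇒≢ a<2+a (sym eq)) ,
  cycleAdj-forward t (suc a) (2 + a) (isCyclicSucc-suc t (suc a)) ,
  cycleAdj-backward t (suc a) a (isCyclicSucc-suc t a)
  where
  a<2+a : a < 2 + a
  a<2+a = <-trans (n<1+n a) (n<1+n (suc a))

cycle-degree : ∀ t v → degree (cycle t) v ≡ 2
cycle-degree t v with cycle-neighbours t (toℕ v) (toℕ<n v)
... | b , c , b< , c< , b≢c , vb , vc =
  ≤-antisym (S4Free⇒degree≤2 (cycle t) (cycle-S4Free t) v)
            (count-≥2 (adj (cycle t) v) (b≢c ∘ fromℕ<-injective b c b< c<)
                      (adjacent-fromℕ< b< vb) (adjacent-fromℕ< c< vc))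
  where
  adjacent-fromℕ< : ∀ {b} (b< : b < 3 + t) →
    cycleAdj t (toℕ v) b ≡ true → adj (cycle t) v (fromℕ< b<) ≡ true
  adjacent-fromℕ< b< vb = subst (λ k → cycleAdj t (toℕ v) k ≡ true) (sym (toℕ-fromℕ< b<)) vb

mainTheorem19 : (n : ℕ) → 3 ≤ n →
    ((G : Graph n) → S4Free G → countM2 G ≤ (n * (n ∸ 3)) / 2) ×
    Σ (Graph n) (λ G → S4Free G × (countM2 G ≡ (n * (n ∸ 3)) / 2))
mainTheorem19 n 3≤n with m≤n⇒∃[o]m+o≡n 3≤n
... | t , refl =
  (λ G free → ≤-half-n*[n∸3] {3 + t} (S4Free⇒countM2-bound 3≤n G free)) ,
  (cycle t , cycle-S4Free t , ≡-half-n*[n∸3] {3 + t} (2-regular⇒countM2 (cycle t) (cycle-degree t)))
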